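{- In the minimum problem described in the context, fix any realization of the values $v_1,\dots,v_n$. If $I_1$ contains some $I_j$ with $j\neq 1$, then $I_1$ belongs to every feasible query set.
   Context: There are $n$ unknown reals $v_1,\dots,v_n$ with given open intervals $I_i=(\ell_i,r_i)\ni v_i$ and query costs $w_i>0$; querying $I_i$ costs $w_i$ and reveals $v_i$. The goal is to identify an index $i$ with $v_i=\min_j v_j$ (the value itself need not be known). The intervals are indexed so that $\ell_1\le\ell_2\le\dots\le\ell_n$, and every two intervals intersect. For a given realization of the values, a set $Q$ of indices is a feasible query set if, after learning $v_i$ for all $i\in Q$ (and knowing only $I_i$ for $i\notin Q$), one can determine an index attaining the minimum.
   Formalization: The values $v_1,\dots,v_n$, the endpoints of the intervals and the realizations quantified over in the definition of a feasible query set are rational rather than real. -}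

module Defs where

open import Data.Nat using (ℕ)
open import Data.Fin using (Fin)
open import Data.Fin.Subset using (Subset; _∈_)
open import Data.Rational using (ℚ; _<_; _≤_)
open import Data.Product using (_×_; ∃)
open import Relation.Binary.PropositionalEquality using (_≡_)

_∈⟨_,_⟩ : ℚ → ℚ → ℚ → Set
x ∈⟨ a , b ⟩ = (a < x) × (x < b)

_⊆I_ : ℚ × ℚ → ℚ × ℚ → Set
(c Data.Product., d) ⊆I (a Data.Product., b) = ∀ x → x ∈⟨ c , d ⟩ → x ∈⟨ a , b ⟩

Realization : {n : ℕ} → (ℓ r : Fin n → ℚ) → (Fin n → ℚ) → Set
Realization ℓ r v = ∀ k → v k ∈⟨ ℓ k , r k ⟩

AgreesOn : {n : ℕ} → Subset n → (Fin n → ℚ) → (Fin n → ℚ) → Set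
AgreesOn Q v v' = ∀ k → k ∈ Q → v' k ≡ v k

IsMinIndex : {n : ℕ} → (Fin n → ℚ) → Fin n → Set
IsMinIndex v i = ∀ k → v i ≤ v k

-- Q is a feasible query set for realization v: knowing v on Q and only the
-- intervals elsewhere, one can name an index that is a minimum index for
-- every realization consistent with this information.
Feasible : {n : ℕ} → (ℓ r : Fin n → ℚ) → (Fin n → ℚ) → Subset n → Set
Feasible ℓ r v Q =
  ∃ λ i → ∀ v' → Realization ℓ r v' → AgreesOn Q v v' → IsMinIndex v' i

{-# OPTIONS --safe #-}
module Submission where

-- If I₁ (index zero here) is not queried, v₁ may be moved anywhere in I₁
-- without changing what the queries reveal, so the certified minimum index i
-- must stay minimal under all such moves. i = 1 fails: v₁ can be pushed above
-- v_j, which lies in I_j ⊆ I₁. i ≠ 1 fails: v₁ can be pushed just above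
-- ℓ₁ ≤ ℓᵢ < vᵢ, undercutting vᵢ.

open import Defs
open import Data.Nat using (ℕ; suc; z≤n)
open import Data.Fin using (Fin; zero; _≟_)
open import Data.Fin.Subset using (Subset; _∈_; _∉_)
open import Data.Fin.Subset.Properties using (_∈?_)
open import Data.Rational using (ℚ; _<_; _≤_)
open import Data.Rational.Properties
  using (<-dense; <-irrefl; <-trans; ≤-trans; <⇒≤; ≤-<-trans; <-≤-trans; ≮⇒≥; _<?_)
open import Data.Product using (_×_; _,_; ∃; proj₁; proj₂)
open import Data.Empty using (⊥-elim)
open import Data.Vec.Functional using (updateAt)
open import Data.Vec.Functional.Properties using (updateAt-updates; updateAt-minimal)
open import Function using (const)
open import Relation.Binary.PropositionalEquality using (_≡_; _≢_; refl; sym; subst; subst₂)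
open import Relation.Nullary using (¬_; yes; no)
import Data.Fin

CertifiesMin : {n : ℕ} → (ℓ r v : Fin n → ℚ) → Subset n → Fin n → Set
CertifiesMin ℓ r v Q i = ∀ v' → Realization ℓ r v' → AgreesOn Q v v' → IsMinIndex v' i

module _ {n : ℕ} {ℓ r v : Fin n → ℚ} {Q : Subset n} {p : Fin n} where

  private
    v[p≔_] : ℚ → Fin n → ℚ
    v[p≔ x ] = updateAt v p (const x)

  realization-updateAt : ∀ {x} → Realization ℓ r v → x ∈⟨ ℓ p , r p ⟩ →
                         Realization ℓ r v[p≔ x ]
  realization-updateAt {x} R x∈Iₚ k with k ≟ p
  ... | yes refl = subst (_∈⟨ ℓ k , r k ⟩) (sym (updateAt-updates k v)) x∈Iₚ
  ... | no k≢p   = subst (_∈⟨ ℓ k , r k ⟩) (sym (updateAt-minimal k p v k≢p)) (R k)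

  agreesOn-updateAt : ∀ {x} → p ∉ Q → AgreesOn Q v v[p≔ x ]
  agreesOn-updateAt p∉Q k k∈Q = updateAt-minimal k p v λ { refl → p∉Q k∈Q }

  certifiesMin-updateAt : ∀ {i x} → CertifiesMin ℓ r v Q i → Realization ℓ r v →
                          p ∉ Q → x ∈⟨ ℓ p , r p ⟩ → IsMinIndex v[p≔ x ] i
  certifiesMin-updateAt cert R p∉Q x∈Iₚ =
    cert _ (realization-updateAt R x∈Iₚ) (agreesOn-updateAt p∉Q)

  certifiesMin⇒≤-unqueried-ℓ : ∀ {i} → CertifiesMin ℓ r v Q i → Realization ℓ r v →
                               p ∉ Q → i ≢ p → v i ≤ ℓ p
  certifiesMin⇒≤-unqueried-ℓ {i} cert R p∉Q i≢p = ≮⇒≥ ℓₚ≮vᵢ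
    where
    ℓₚ≮vᵢ : ¬ (ℓ p < v i)
    ℓₚ≮vᵢ ℓₚ<vᵢ with v p <? v i
    ... | yes vₚ<vᵢ = <-irrefl refl (≤-<-trans (cert v R (λ _ _ → refl) p) vₚ<vᵢ)
    ... | no vₚ≮vᵢ with <-dense ℓₚ<vᵢ
    ... | x , ℓₚ<x , x<vᵢ = <-irrefl refl (≤-<-trans vᵢ≤x x<vᵢ)
      where
      x<rₚ : x < r p
      x<rₚ = <-≤-trans x<vᵢ (<⇒≤ (≤-<-trans (≮⇒≥ vₚ≮vᵢ) (proj₂ (R p))))
      vᵢ≤x : v i ≤ x
      vᵢ≤x = subst₂ _≤_ (updateAt-minimal i p v i≢p) (updateAt-updates p v)
                    (certifiesMin-updateAt cert R p∉Q (ℓₚ<x , x<rₚ) p)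

  certifiesMin⇒unqueried-r-≤ : ∀ {k} → CertifiesMin ℓ r v Q p → Realization ℓ r v →
                               p ∉ Q → k ≢ p → ℓ p < v k → r p ≤ v k
  certifiesMin⇒unqueried-r-≤ {k} cert R p∉Q k≢p ℓₚ<vₖ = ≮⇒≥ vₖ≮rₚ
    where
    vₖ≮rₚ : ¬ (v k < r p)
    vₖ≮rₚ vₖ<rₚ with <-dense vₖ<rₚ
    ... | x , vₖ<x , x<rₚ = <-irrefl refl (≤-<-trans x≤vₖ vₖ<x)
      where
      x≤vₖ : x ≤ v k
      x≤vₖ = subst₂ _≤_ (updateAt-updates p v) (updateAt-minimal k p v k≢p)
                    (certifiesMin-updateAt cert R p∉Q (<-trans ℓₚ<vₖ vₖ<x , x<rₚ) k)

proposition2 : (m : ℕ) (ℓ r : Fin (suc m) → ℚ)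
    → (∀ i → ℓ i < r i)
    → (∀ i j → i Data.Fin.≤ j → ℓ i ≤ ℓ j)
    → (∀ i j → ∃ λ x → x ∈⟨ ℓ i , r i ⟩ × x ∈⟨ ℓ j , r j ⟩)
    → (v : Fin (suc m) → ℚ) → Realization ℓ r v
    → (j : Fin (suc m)) → ¬ (j ≡ zero) → (ℓ j , r j) ⊆I (ℓ zero , r zero)
    → (Q : Subset (suc m)) → Feasible ℓ r v Q
    → zero ∈ Q
proposition2 m ℓ r _ sorted _ v R j j≢0 Iⱼ⊆I₀ Q (i , cert) with zero ∈? Q | i ≟ zero
... | yes 0∈Q | _        = 0∈Q
... | no 0∉Q  | yes refl = ⊥-elim (<-irrefl refl (<-≤-trans vⱼ<r₀ r₀≤vⱼ))
  where
  ℓ₀<vⱼ : ℓ zero < v j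
  ℓ₀<vⱼ = proj₁ (Iⱼ⊆I₀ (v j) (R j))
  vⱼ<r₀ : v j < r zero
  vⱼ<r₀ = proj₂ (Iⱼ⊆I₀ (v j) (R j))
  r₀≤vⱼ : r zero ≤ v j
  r₀≤vⱼ = certifiesMin⇒unqueried-r-≤ cert R 0∉Q j≢0 ℓ₀<vⱼ
... | no 0∉Q  | no i≢0   = ⊥-elim (<-irrefl refl (≤-<-trans vᵢ≤ℓᵢ (proj₁ (R i))))
  where
  vᵢ≤ℓᵢ : v i ≤ ℓ i
  vᵢ≤ℓᵢ = ≤-trans (certifiesMin⇒≤-unqueried-ℓ cert R 0∉Q i≢0) (sorted zero i z≤n)
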